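{- Let $n\ge 3$ and let $V$ be the set of all elements of the pairs $e_0,\dots,e_n$, where $e_l=\{\sigma(l,l+1,l+3),\sigma(l,l+2,l+3)\}$ for $0\le l\le n-3$, $e_{n-2}=\{\sigma(0,n-2,n-1),\sigma(0,n-2,n)\}$, $e_{n-1}=\{\sigma(1,n-1,n),\sigma(0,1,n-1)\}$, $e_n=\{\sigma(0,2,n),\sigma(1,2,n)\}$. Let $H$ be the subgroup of $\mathrm{Sym}_n$ generated by $V$. Then $H=\mathrm{Sym}_n$ if $n$ is odd and $H=\mathrm{Alt}_n$ if $n$ is even.
   Context: $\mathrm{Sym}_n$ is the symmetric group on $[n]$, permutations in one-line notation, $(\pi\circ\rho)(t)=\pi(\rho(t))$; $\mathrm{Alt}_n$ is the alternating group. For integers $0\le i<j<k\le n$ the block transposition $\sigma(i,j,k)$ is $[1\cdots i\ \ j+1\cdots k\ \ i+1\cdots j\ \ k+1\cdots n]$. -}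

module Defs where

open import Data.Nat using (ℕ; zero; suc; _+_; _∸_; _<_; _<ᵇ_; _<?_)
open import Data.Fin using (Fin; toℕ; fromℕ<)
open import Data.List using (List; []; _∷_; _++_; map; concatMap; upTo; allFin)
open import Data.Nat.ListAction using (sum)
open import Data.Bool using (Bool; true; false; if_then_else_; _∧_)
open import Data.Product using (_×_; _,_)
open import Data.List.Membership.Propositional using (_∈_)
open import Relation.Nullary using (yes; no)
open import Relation.Binary.PropositionalEquality using (_≡_)
open import Function using (_∘_; id)

-- Block transposition σ(i,j,k) = [1..i, j+1..k, i+1..j, k+1..n] in one-line
-- notation, written 0-based on positions t = 0..n-1 (t stands for t+1).
σℕ : ℕ → ℕ → ℕ → ℕ → ℕ
σℕ i j k t =
  if t <ᵇ i then t
  else if t <ᵇ i + (k ∸ j) then t + (j ∸ i)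
  else if t <ᵇ k then t ∸ (k ∸ j)
  else t

-- As a map Fin n → Fin n.  For 0 ≤ i < j < k ≤ n the value is always < n,
-- so the fallback branch is never used for the triples below.
σ : (n : ℕ) → ℕ → ℕ → ℕ → Fin n → Fin n
σ n i j k t with σℕ i j k (toℕ t) <? n
... | yes p = fromℕ< p
... | no _  = t

triples : ℕ → List (ℕ × ℕ × ℕ)
triples n =
  concatMap (λ l → (l , suc l , l + 3) ∷ (l , l + 2 , l + 3) ∷ []) (upTo (n ∸ 2))  -- l = 0..n-3
  ++ (0 , n ∸ 2 , n ∸ 1) ∷ (0 , n ∸ 2 , n) ∷ []
  ++ (1 , n ∸ 1 , n) ∷ (0 , 1 , n ∸ 1) ∷ []
  ++ (0 , 2 , n) ∷ (1 , 2 , n) ∷ []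

V : (n : ℕ) → (Fin n → Fin n) → Set
V n f = Data.Product.Σ (ℕ × ℕ × ℕ) (λ { (i , j , k) → ((i , j , k) ∈ triples n) × (∀ t → f t ≡ σ n i j k t) })

data ⟨_⟩ {n : ℕ} (S : (Fin n → Fin n) → Set) : (Fin n → Fin n) → Set where
  gen  : ∀ {f} → S f → ⟨ S ⟩ f
  one  : ⟨ S ⟩ id
  comp : ∀ {f g} → ⟨ S ⟩ f → ⟨ S ⟩ g → ⟨ S ⟩ (f ∘ g)
  inv  : ∀ {f g} → ⟨ S ⟩ f → (∀ t → f (g t) ≡ t) → (∀ t → g (f t) ≡ t) → ⟨ S ⟩ g
  ext  : ∀ {f g} → ⟨ S ⟩ f → (∀ t → f t ≡ g t) → ⟨ S ⟩ g

inversions : {n : ℕ} → (Fin n → Fin n) → ℕ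
inversions {n} f =
  sum (map (λ a → sum (map (λ b →
        if (toℕ a <ᵇ toℕ b) ∧ (toℕ (f b) <ᵇ toℕ (f a)) then 1 else 0)
      (allFin n))) (allFin n))

-- Write sₚ for the transposition of the adjacent positions p and p+1.  The block
-- transposition σ(i,j,k) is a product of (j-i)(k-j) adjacent transpositions, and
-- right multiplication by sₚ changes the number of inversions by exactly one, so the
-- inversion count of a word in the sₚ has the parity of its length.  For n even every
-- generator has (j-i)(k-j) even, hence H ⊆ Alt_n.  Conversely σ(l,l+1,l+3) = sₗ sₗ₊₁,
-- and chaining these gives every product sₓ s_y, i.e. every even word; bubble sort
-- writes each permutation as a word, so Alt_n ⊆ H.  For n odd the generator
-- σ(0,1,n-1) is a word of odd length n-2, and then H contains every word.

module Submission where

open import Defs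
open import Data.Nat.Divisibility using (_∣_; divides)
open import Data.Fin using (Fin)
open import Relation.Nullary using (¬_)
open import Function.Definitions using (Bijective; Injective)
open import Function.Bundles using (_⇔_; mk⇔)

open import Data.Bool using (true; false; if_then_else_; T; _∧_)
open import Data.Fin as Fin using (zero; suc; toℕ; fromℕ<; punchIn)
open import Data.Fin.Permutation using (permutation)
open import Data.Fin.Properties using (toℕ-fromℕ<; toℕ-injective; toℕ<n; fromℕ<-toℕ; punchInᵢ≢i)
open import Data.List using (List; []; _∷_; _++_; length; reverse; map; tabulate; allFin; concatMap; upTo)
open import Data.List.Membership.Propositional using (_∈_; find)
open import Data.List.Membership.Propositional.Properties
  using (∈-++⁺ˡ; ∈-++⁺ʳ; ∈-++⁻; ∈-concatMap⁺; ∈-concatMap⁻; ∈-upTo⁺; ∈-upTo⁻)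
open import Data.List.Properties using (unfold-reverse; length-++; length-reverse; map-tabulate; map-cong)
open import Data.List.Relation.Binary.Permutation.Propositional using (↭-sym)
open import Data.List.Relation.Binary.Permutation.Propositional.Properties using (All-resp-↭; ↭-reverse)
open import Data.List.Relation.Unary.All using (All; []; _∷_)
open import Data.List.Relation.Unary.All.Properties using (++⁺)
open import Data.List.Relation.Unary.Any using (here; there)
import Data.List.Relation.Unary.Any as Any
open import Data.Nat using (ℕ; zero; suc; _+_; _*_; _∸_; _≤_; _<_; _<ᵇ_; _<?_; _≟_; z≤n; s≤s; z<s; parity)
import Data.Nat.ListAction as ListAction
open import Data.Nat.Properties
open import Data.Nat.Tactic.RingSolver using (solve-∀)
open import Data.Parity.Base using (0ℙ; 1ℙ; _⁻¹)
import Data.Parity.Base as ℙ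
import Data.Parity.Properties as ℙ
open import Data.Parity.Properties using (⁻¹-involutive; suc-homo-⁻¹; +-homo-+; *-homo-*)
open import Data.Product using (Σ; ∃-syntax; _×_; _,_; proj₁; proj₂)
open import Data.Product.Properties using (×-≡,≡→≡)
open import Data.Sum as Sum using (_⊎_; inj₁; inj₂)
open import Data.Vec.Functional using (removeAt; updateAt)
open import Data.Vec.Functional.Properties using (updateAt-updates; updateAt-minimal)
open import Function using (_∘_; id; case_of_)
open import Relation.Binary using (tri<; tri≈; tri>)
open import Relation.Binary.PropositionalEquality
open import Relation.Nullary using (yes; no; contradiction)

open import Algebra.Properties.CommutativeSemigroup +-commutativeSemigroup using (xy∙z≈xz∙y; xy∙z≈zy∙x)
open import Algebra.Properties.CommutativeMonoid.Sum +-0-commutativeMonoid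
  using (sum; sum-syntax; sum-cong-≗; sum-remove; sum-permute; sum-replicate-zero)

<ᵇ-true : ∀ {m n} → m < n → (m <ᵇ n) ≡ true
<ᵇ-true {m} {n} m<n with m <ᵇ n | <⇒<ᵇ m<n
... | true | _ = refl

<ᵇ-false : ∀ {m n} → n ≤ m → (m <ᵇ n) ≡ false
<ᵇ-false {m} {n} n≤m with m <ᵇ n in eq
... | false = refl
... | true  = contradiction (<ᵇ⇒< m n (subst T (sym eq) _)) (≤⇒≯ n≤m)

<ᵇ-irrefl : ∀ m → (m <ᵇ m) ≡ false
<ᵇ-irrefl m = <ᵇ-false {m} ≤-refl

blockSwap : ℕ → ℕ → ℕ → ℕ → ℕ
blockSwap i a b t =
  if t <ᵇ i then t
  else if t <ᵇ i + b then t + a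
  else if t <ᵇ i + a + b then t ∸ b
  else t

σℕ-blockSwap : ∀ i a b t → σℕ i (i + a) (i + a + b) t ≡ blockSwap i a b t
σℕ-blockSwap i a b t rewrite m+n∸m≡n (i + a) b | m+n∸m≡n i a = refl

module _ (i a b : ℕ) {t : ℕ} where

  blockSwap-before : t < i → blockSwap i a b t ≡ t
  blockSwap-before t<i rewrite <ᵇ-true t<i = refl

  blockSwap-up : i ≤ t → t < i + b → blockSwap i a b t ≡ t + a
  blockSwap-up i≤t t<i+b rewrite <ᵇ-false i≤t | <ᵇ-true t<i+b = refl

  blockSwap-down : i + b ≤ t → t < i + a + b → blockSwap i a b t ≡ t ∸ b
  blockSwap-down i+b≤t t<k
    rewrite <ᵇ-false (≤-trans (m≤m+n i b) i+b≤t) | <ᵇ-false i+b≤t | <ᵇ-true t<k = refl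

  blockSwap-after : i + a + b ≤ t → blockSwap i a b t ≡ t
  blockSwap-after k≤t
    rewrite <ᵇ-false {t} {i} (≤-trans (≤-trans (m≤m+n i a) (m≤m+n (i + a) b)) k≤t)
          | <ᵇ-false {t} {i + b} (≤-trans (+-monoˡ-≤ b (m≤m+n i a)) k≤t)
          | <ᵇ-false k≤t = refl

data Region (i a b t : ℕ) : Set where
  before : t < i → Region i a b t
  up     : i ≤ t → t < i + b → Region i a b t
  down   : i + b ≤ t → t < i + a + b → Region i a b t
  after  : i + a + b ≤ t → Region i a b t

region : ∀ i a b t → Region i a b t
region i a b t with t <? i | t <? i + b | t <? i + a + b
... | yes t<i | _ | _ = before t<i
... | no t≮i | yes t<i+b | _ = up (≮⇒≥ t≮i) t<i+b
... | no _ | no t≮i+b | yes t<k = down (≮⇒≥ t≮i+b) t<k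
... | no _ | no _ | no t≮k = after (≮⇒≥ t≮k)

blockSwap-identityʳ : ∀ i a t → blockSwap i a 0 t ≡ t
blockSwap-identityʳ i a t with region i a 0 t
... | before t<i      = blockSwap-before i a 0 t<i
... | up i≤t t<i+0    = contradiction (subst (_≤ t) (sym (+-identityʳ i)) i≤t) (<⇒≱ t<i+0)
... | down i+0≤t t<k  = blockSwap-down i a 0 i+0≤t t<k
... | after k≤t       = blockSwap-after i a 0 k≤t

blockSwap-identityˡ : ∀ i b t → blockSwap i 0 b t ≡ t
blockSwap-identityˡ i b t with region i 0 b t
... | before t<i      = blockSwap-before i 0 b t<i
... | up i≤t t<i+b    = trans (blockSwap-up i 0 b i≤t t<i+b) (+-identityʳ t)
... | down i+b≤t t<k  = contradiction (subst (λ x → t < x + b) (+-identityʳ i) t<k) (≤⇒≯ i+b≤t)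
... | after k≤t       = blockSwap-after i 0 b k≤t

m+1+1≡2+m : ∀ m → m + 1 + 1 ≡ suc (suc m)
m+1+1≡2+m = solve-∀

i+a+[1+b]≡i+b+a+1 : ∀ i a b → i + a + suc b ≡ i + b + a + 1
i+a+[1+b]≡i+b+a+1 = solve-∀

swapℕ : ℕ → ℕ → ℕ
swapℕ p = blockSwap p 1 1

swapℕ-left : ∀ p → swapℕ p p ≡ suc p
swapℕ-left p = trans (blockSwap-up p 1 1 ≤-refl (m<m+n p z<s)) (+-comm p 1)

swapℕ-right : ∀ p → swapℕ p (suc p) ≡ p
swapℕ-right p = blockSwap-down p 1 1 (≤-reflexive (+-comm p 1)) (≤-reflexive (sym (m+1+1≡2+m p)))

swapℕ-other : ∀ p {t} → t ≢ p → t ≢ suc p → swapℕ p t ≡ t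
swapℕ-other p {t} t≢p t≢1+p with region p 1 1 t
... | before t<p     = blockSwap-before p 1 1 t<p
... | up p≤t t<p+1   = contradiction (≤-antisym (≤-pred (subst (t <_) (+-comm p 1) t<p+1)) p≤t) t≢p
... | down p+1≤t t<k = contradiction (≤-antisym (≤-pred (subst (t <_) (m+1+1≡2+m p) t<k)) (subst (_≤ t) (+-comm p 1) p+1≤t)) t≢1+p
... | after k≤t      = blockSwap-after p 1 1 k≤t

blockSwap-splitʳ : ∀ i a b t → blockSwap i a (suc b) t ≡ blockSwap i a b (blockSwap (i + b) a 1 t)
blockSwap-splitʳ i a b t with region i a (suc b) t
... | before t<i = trans (blockSwap-before i a (suc b) t<i) (sym (trans
  (cong (blockSwap i a b) (blockSwap-before (i + b) a 1 (<-≤-trans t<i (m≤m+n i b))))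
  (blockSwap-before i a b t<i)))
... | up i≤t t<i+1+b with t <? i + b
...   | yes t<i+b = trans (blockSwap-up i a (suc b) i≤t t<i+1+b) (sym (begin
  blockSwap i a b (blockSwap (i + b) a 1 t) ≡⟨ cong (blockSwap i a b) (blockSwap-before (i + b) a 1 t<i+b) ⟩
  blockSwap i a b t                         ≡⟨ blockSwap-up i a b i≤t t<i+b ⟩
  t + a                                     ∎))
  where open ≡-Reasoning
...   | no t≮i+b = trans (blockSwap-up i a (suc b) i≤t t<i+1+b) (sym (begin
  blockSwap i a b (blockSwap (i + b) a 1 t) ≡⟨ cong (blockSwap i a b) (blockSwap-up (i + b) a 1 (≮⇒≥ t≮i+b) t<i+b+1) ⟩
  blockSwap i a b (t + a)                   ≡⟨ blockSwap-after i a b (subst (_≤ t + a) (xy∙z≈xz∙y i b a) (+-monoˡ-≤ a (≮⇒≥ t≮i+b))) ⟩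
  t + a                                     ∎))
  where
  open ≡-Reasoning
  t<i+b+1 : t < i + b + 1
  t<i+b+1 = subst (t <_) (trans (+-suc i b) (+-comm 1 (i + b))) t<i+1+b
blockSwap-splitʳ i a b (suc t) | down i+1+b≤t t<k = trans (blockSwap-down i a (suc b) i+1+b≤t t<k) (sym (begin
  blockSwap i a b (blockSwap (i + b) a 1 (suc t)) ≡⟨ cong (blockSwap i a b) (blockSwap-down (i + b) a 1 i+b+1≤1+t 1+t<i+b+a+1) ⟩
  blockSwap i a b t                               ≡⟨ blockSwap-down i a b (≤-pred i+1+b≤1+t) (≤-pred 1+t<1+k) ⟩
  t ∸ b                                           ∎))
  where
  open ≡-Reasoning
  i+1+b≤1+t : suc (i + b) ≤ suc t
  i+1+b≤1+t = subst (_≤ suc t) (+-suc i b) i+1+b≤t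
  i+b+1≤1+t : i + b + 1 ≤ suc t
  i+b+1≤1+t = subst (_≤ suc t) (+-comm 1 (i + b)) i+1+b≤1+t
  1+t<1+k : suc t < suc (i + a + b)
  1+t<1+k = subst (suc t <_) (+-suc (i + a) b) t<k
  1+t<i+b+a+1 : suc t < i + b + a + 1
  1+t<i+b+a+1 = subst (suc t <_) (i+a+[1+b]≡i+b+a+1 i a b) t<k
blockSwap-splitʳ i a b zero | down i+1+b≤0 _ = contradiction (subst (_≤ 0) (+-suc i b) i+1+b≤0) λ ()
blockSwap-splitʳ i a b t | after k≤t = trans (blockSwap-after i a (suc b) k≤t) (sym (trans
  (cong (blockSwap i a b) (blockSwap-after (i + b) a 1 (subst (_≤ t) (i+a+[1+b]≡i+b+a+1 i a b) k≤t)))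
  (blockSwap-after i a b (≤-trans (+-monoʳ-≤ (i + a) (n≤1+n b)) k≤t))))

blockSwap-splitˡ : ∀ p a t → blockSwap p (suc a) 1 t ≡ blockSwap (suc p) a 1 (swapℕ p t)
blockSwap-splitˡ p a t with <-cmp t p
... | tri< t<p _ _ = trans (blockSwap-before p (suc a) 1 t<p) (sym (trans
  (cong (blockSwap (suc p) a 1) (blockSwap-before p 1 1 t<p))
  (blockSwap-before (suc p) a 1 (m<n⇒m<1+n t<p))))
... | tri≈ _ refl _ = begin
  blockSwap t (suc a) 1 t             ≡⟨ blockSwap-up t (suc a) 1 ≤-refl (m<m+n t z<s) ⟩
  t + suc a                           ≡⟨ +-suc t a ⟩
  suc t + a                           ≡⟨ blockSwap-up (suc t) a 1 ≤-refl (m<m+n (suc t) z<s) ⟨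
  blockSwap (suc t) a 1 (suc t)       ≡⟨ cong (blockSwap (suc t) a 1) (swapℕ-left t) ⟨
  blockSwap (suc t) a 1 (swapℕ t t)   ∎
  where open ≡-Reasoning
... | tri> _ _ p<t with t ≟ suc p
...   | yes refl = begin
  blockSwap p (suc a) 1 (suc p)         ≡⟨ blockSwap-down p (suc a) 1 (≤-reflexive (+-comm p 1)) 1+p<p+1+a+1 ⟩
  p                                     ≡⟨ blockSwap-before (suc p) a 1 (n<1+n p) ⟨
  blockSwap (suc p) a 1 p               ≡⟨ cong (blockSwap (suc p) a 1) (swapℕ-right p) ⟨
  blockSwap (suc p) a 1 (swapℕ p (suc p)) ∎
  where
  open ≡-Reasoning
  1+p<p+1+a+1 : suc p < p + suc a + 1
  1+p<p+1+a+1 = subst (suc p <_) (sym (cong (_+ 1) (+-suc p a))) (s≤s (≤-trans (≤-reflexive (+-comm 1 p)) (+-monoˡ-≤ 1 (m≤m+n p a))))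
...   | no t≢1+p = trans (blockSwap-beyond-swap (region (suc p) a 1 t))
                         (cong (blockSwap (suc p) a 1) (sym (swapℕ-other p (<⇒≢ p<t ∘ sym) t≢1+p)))
  where
  p+1+a+1≡1+p+a+1 : p + suc a + 1 ≡ suc p + a + 1
  p+1+a+1≡1+p+a+1 = cong (_+ 1) (+-suc p a)
  2+p≤t : suc (suc p) ≤ t
  2+p≤t = ≤∧≢⇒< p<t (t≢1+p ∘ sym)
  blockSwap-beyond-swap : Region (suc p) a 1 t → blockSwap p (suc a) 1 t ≡ blockSwap (suc p) a 1 t
  blockSwap-beyond-swap (before t<1+p) = contradiction t<1+p (≤⇒≯ p<t)
  blockSwap-beyond-swap (up _ t<1+p+1) = contradiction (subst (t <_) (+-comm (suc p) 1) t<1+p+1) (≤⇒≯ 2+p≤t)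
  blockSwap-beyond-swap (down 1+p+1≤t t<k) = trans
    (blockSwap-down p (suc a) 1 (≤-trans (+-monoˡ-≤ 1 (n≤1+n p)) 1+p+1≤t) (subst (t <_) (sym p+1+a+1≡1+p+a+1) t<k))
    (sym (blockSwap-down (suc p) a 1 1+p+1≤t t<k))
  blockSwap-beyond-swap (after k≤t) = trans
    (blockSwap-after p (suc a) 1 (subst (_≤ t) (sym p+1+a+1≡1+p+a+1) k≤t))
    (sym (blockSwap-after (suc p) a 1 k≤t))

swapℕ-involutive : ∀ p t → swapℕ p (swapℕ p t) ≡ t
swapℕ-involutive p t with t ≟ p | t ≟ suc p
... | yes refl | _        = trans (cong (swapℕ p) (swapℕ-left p)) (swapℕ-right p)
... | no _     | yes refl = trans (cong (swapℕ p) (swapℕ-right p)) (swapℕ-left p)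
... | no t≢p   | no t≢1+p = trans (cong (swapℕ p) (swapℕ-other p t≢p t≢1+p)) (swapℕ-other p t≢p t≢1+p)

<ᵇ-sucʳ : ∀ {x} p → x ≢ p → (x <ᵇ p) ≡ (x <ᵇ suc p)
<ᵇ-sucʳ {x} p x≢p with <-cmp x p
... | tri< x<p _ _ = trans (<ᵇ-true x<p) (sym (<ᵇ-true (m<n⇒m<1+n x<p)))
... | tri≈ _ x≡p _ = contradiction x≡p x≢p
... | tri> _ _ p<x = trans (<ᵇ-false (<⇒≤ p<x)) (sym (<ᵇ-false p<x))

<ᵇ-sucˡ : ∀ {x} p → x ≢ suc p → (suc p <ᵇ x) ≡ (p <ᵇ x)
<ᵇ-sucˡ {x} p x≢1+p with <-cmp p x
... | tri< p<x _ _ = trans (<ᵇ-true (≤∧≢⇒< p<x (x≢1+p ∘ sym))) (sym (<ᵇ-true p<x))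
... | tri≈ _ refl _ = trans (<ᵇ-false (n≤1+n p)) (sym (<ᵇ-irrefl p))
... | tri> _ _ x<p = trans (<ᵇ-false (≤-trans (<⇒≤ x<p) (n≤1+n p))) (sym (<ᵇ-false (<⇒≤ x<p)))

swapℕ-<ᵇ : ∀ p {x y} → ¬ (x ≡ p × y ≡ suc p) → ¬ (x ≡ suc p × y ≡ p) →
           (swapℕ p x <ᵇ swapℕ p y) ≡ (x <ᵇ y)
swapℕ-<ᵇ p {x} {y} ¬xy ¬yx with x ≟ p | x ≟ suc p | y ≟ p | y ≟ suc p
... | yes refl | _       | yes refl | _       = trans (cong₂ _<ᵇ_ (swapℕ-left x) (swapℕ-left x)) (trans (<ᵇ-irrefl (suc x)) (sym (<ᵇ-irrefl x)))
... | yes refl | _       | no _     | yes refl = contradiction (refl , refl) ¬xy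
... | yes refl | _       | no y≢p   | no y≢1+p = trans (cong₂ _<ᵇ_ (swapℕ-left x) (swapℕ-other x y≢p y≢1+p)) (<ᵇ-sucˡ x y≢1+p)
... | no _     | yes refl | yes refl | _       = contradiction (refl , refl) ¬yx
... | no _     | yes refl | no _    | yes refl = trans (cong₂ _<ᵇ_ (swapℕ-right p) (swapℕ-right p)) (trans (<ᵇ-irrefl p) (sym (<ᵇ-irrefl (suc p))))
... | no _     | yes refl | no y≢p  | no y≢1+p = trans (cong₂ _<ᵇ_ (swapℕ-right p) (swapℕ-other p y≢p y≢1+p)) (sym (<ᵇ-sucˡ p y≢1+p))
... | no x≢p   | no x≢1+p | yes refl | _       = trans (cong₂ _<ᵇ_ (swapℕ-other y x≢p x≢1+p) (swapℕ-left y)) (sym (<ᵇ-sucʳ y x≢p))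
... | no x≢p   | no x≢1+p | no _    | yes refl = trans (cong₂ _<ᵇ_ (swapℕ-other p x≢p x≢1+p) (swapℕ-right p)) (<ᵇ-sucʳ p x≢p)
... | no x≢p   | no x≢1+p | no y≢p  | no y≢1+p = cong₂ _<ᵇ_ (swapℕ-other p x≢p x≢1+p) (swapℕ-other p y≢p y≢1+p)

blockSwap-< : ∀ i a b {n t} → i + a + b ≤ n → t < n → blockSwap i a b t < n
blockSwap-< i a b {n} {t} k≤n t<n with region i a b t
... | before t<i     = subst (_< n) (sym (blockSwap-before i a b t<i)) t<n
... | up i≤t t<i+b   = subst (_< n) (sym (blockSwap-up i a b i≤t t<i+b))
                         (<-≤-trans (+-monoˡ-< a t<i+b) (subst (_≤ n) (xy∙z≈xz∙y i a b) k≤n))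
... | down i+b≤t t<k = subst (_< n) (sym (blockSwap-down i a b i+b≤t t<k)) (≤-<-trans (m∸n≤m t b) t<n)
... | after k≤t      = subst (_< n) (sym (blockSwap-after i a b k≤t)) t<n

parity-suc : ∀ m → parity (suc m) ≡ parity m ⁻¹
parity-suc m = trans (sym (⁻¹-involutive (parity (suc m)))) (cong _⁻¹ (suc-homo-⁻¹ m))

2∣⇒parity≡0ℙ : ∀ {m} → 2 ∣ m → parity m ≡ 0ℙ
2∣⇒parity≡0ℙ (divides q refl) = trans (*-homo-* q 2) (ℙ.*-zeroʳ (parity q))

parity≡0ℙ⇒2∣ : ∀ m → parity m ≡ 0ℙ → 2 ∣ m
parity≡0ℙ⇒2∣ zero          _ = divides 0 refl
parity≡0ℙ⇒2∣ (suc (suc m)) e with parity≡0ℙ⇒2∣ m e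
... | divides q m≡q*2 = divides (suc q) (cong (λ k → 2 + k) m≡q*2)

¬2∣⇒parity≡1ℙ : ∀ {m} → ¬ 2 ∣ m → parity m ≡ 1ℙ
¬2∣⇒parity≡1ℙ {m} ¬2∣m with parity m in eq
... | 1ℙ = refl
... | 0ℙ = contradiction (parity≡0ℙ⇒2∣ m eq) ¬2∣m

parity-*-evenˡ : ∀ a b → parity a ≡ 0ℙ → parity (a * b) ≡ 0ℙ
parity-*-evenˡ a b pa = trans (*-homo-* a b) (cong (ℙ._* parity b) pa)

parity-*-evenʳ : ∀ a b → parity b ≡ 0ℙ → parity (a * b) ≡ 0ℙ
parity-*-evenʳ a b pb = trans (*-homo-* a b) (trans (cong (parity a ℙ.*_) pb) (ℙ.*-zeroʳ (parity a)))

parity-length-++ : ∀ {A : Set} (u v : List A) → parity (length (u ++ v)) ≡ parity (length u) ℙ.+ parity (length v)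
parity-length-++ u v = trans (cong parity (length-++ u)) (+-homo-+ (length u) (length v))

listSum-map-allFin : ∀ {m} (g : Fin m → ℕ) → ListAction.sum (map g (allFin m)) ≡ sum g
listSum-map-allFin {m} g = trans (cong ListAction.sum (map-tabulate id g)) (listSum-tabulate g)
  where
  listSum-tabulate : ∀ {m} (g : Fin m → ℕ) → ListAction.sum (tabulate g) ≡ sum g
  listSum-tabulate {zero}  g = refl
  listSum-tabulate {suc m} g = cong (g zero +_) (listSum-tabulate (g ∘ suc))

sum-exchange₁ : ∀ {m} (F G : Fin m → ℕ) c → (∀ x → x ≢ c → F x ≡ G x) → sum F + G c ≡ sum G + F c
sum-exchange₁ {suc m} F G c F≡G = begin
  sum F + G c                         ≡⟨ cong (_+ G c) (sum-remove F) ⟩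
  F c + sum (removeAt F c) + G c      ≡⟨ cong (λ r → F c + r + G c) (sum-cong-≗ (λ x → F≡G (punchIn c x) (punchInᵢ≢i c x))) ⟩
  F c + sum (removeAt G c) + G c      ≡⟨ xy∙z≈zy∙x (F c) _ (G c) ⟩
  G c + sum (removeAt G c) + F c      ≡⟨ cong (_+ F c) (sum-remove G) ⟨
  sum G + F c                         ∎
  where open ≡-Reasoning

sum-exchange₂ : ∀ {m} (F G : Fin m → ℕ) {c d} → c ≢ d → (∀ x → x ≢ c → x ≢ d → F x ≡ G x) →
                sum F + G c + G d ≡ sum G + F c + F d
sum-exchange₂ F G {c} {d} c≢d F≡G = begin
  sum F + G c + G d     ≡⟨ cong (λ y → sum F + y + G d) (updateAt-updates c F) ⟨
  sum F + H c + G d     ≡⟨ cong (_+ G d) (sum-exchange₁ F H c (λ x x≢c → sym (updateAt-minimal x c F x≢c))) ⟩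
  sum H + F c + G d     ≡⟨ xy∙z≈xz∙y (sum H) (F c) (G d) ⟩
  sum H + G d + F c     ≡⟨ cong (_+ F c) (sum-exchange₁ H G d H≡G) ⟩
  sum G + H d + F c     ≡⟨ cong (λ y → sum G + y + F c) (updateAt-minimal d c F (c≢d ∘ sym)) ⟩
  sum G + F d + F c     ≡⟨ xy∙z≈xz∙y (sum G) (F d) (F c) ⟩
  sum G + F c + F d     ∎
  where
  open ≡-Reasoning
  H : Fin _ → ℕ
  H = updateAt F c (λ _ → G c)
  H≡G : ∀ x → x ≢ d → H x ≡ G x
  H≡G x x≢d with x Fin.≟ c
  ... | yes refl = updateAt-updates c F
  ... | no x≢c   = trans (updateAt-minimal x c F x≢c) (F≡G x x≢c x≢d)

≗-bijective : ∀ {A B : Set} {f g : A → B} → f ≗ g → Bijective _≡_ _≡_ g → Bijective _≡_ _≡_ f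
≗-bijective {f = f} {g} f≗g (g-inj , g-surj) =
  (λ {x} {y} fx≡fy → g-inj (trans (sym (f≗g x)) (trans fx≡fy (f≗g y)))) ,
  (λ y → proj₁ (g-surj y) , λ {z} z≡x → trans (f≗g z) (proj₂ (g-surj y) z≡x))

module Words (n : ℕ) where

  block : ℕ → ℕ → ℕ → Fin n → Fin n
  block i a b = σ n i (i + a) (i + a + b)

  toℕ-block : ∀ i a b → i + a + b ≤ n → ∀ t → toℕ (block i a b t) ≡ blockSwap i a b (toℕ t)
  toℕ-block i a b k≤n t with σℕ i (i + a) (i + a + b) (toℕ t) <? n
  ... | yes σt<n = trans (toℕ-fromℕ< σt<n) (σℕ-blockSwap i a b (toℕ t))
  ... | no σt≮n  = contradiction (subst (_< n) (sym (σℕ-blockSwap i a b (toℕ t))) (blockSwap-< i a b k≤n (toℕ<n t))) σt≮n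

  Adj : ℕ → Set
  Adj p = suc p < n

  s : ℕ → Fin n → Fin n
  s p = block p 1 1

  toℕ-s : ∀ {p} → Adj p → ∀ t → toℕ (s p t) ≡ swapℕ p (toℕ t)
  toℕ-s {p} p+1<n = toℕ-block p 1 1 (subst (_≤ n) (sym (m+1+1≡2+m p)) p+1<n)

  s-involutive : ∀ {p} → Adj p → ∀ t → s p (s p t) ≡ t
  s-involutive {p} adj t = toℕ-injective (begin
    toℕ (s p (s p t))         ≡⟨ toℕ-s adj (s p t) ⟩
    swapℕ p (toℕ (s p t))     ≡⟨ cong (swapℕ p) (toℕ-s adj t) ⟩
    swapℕ p (swapℕ p (toℕ t)) ≡⟨ swapℕ-involutive p (toℕ t) ⟩
    toℕ t                     ∎)
    where open ≡-Reasoning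

  lo hi : ∀ {p} → Adj p → Fin n
  lo {p} adj = fromℕ< (<-trans (n<1+n p) adj)
  hi adj     = fromℕ< adj

  toℕ-lo : ∀ {p} (adj : Adj p) → toℕ (lo adj) ≡ p
  toℕ-lo {p} adj = toℕ-fromℕ< (<-trans (n<1+n p) adj)

  toℕ-hi : ∀ {p} (adj : Adj p) → toℕ (hi adj) ≡ suc p
  toℕ-hi adj = toℕ-fromℕ< adj

  lo≢hi : ∀ {p} (adj : Adj p) → lo adj ≢ hi adj
  lo≢hi adj lo≡hi = 1+n≢n (trans (sym (toℕ-hi adj)) (trans (cong toℕ (sym lo≡hi)) (toℕ-lo adj)))

  toℕ-s-lo : ∀ {p} (adj : Adj p) → toℕ (s p (lo adj)) ≡ suc p
  toℕ-s-lo {p} adj = trans (toℕ-s adj (lo adj)) (trans (cong (swapℕ p) (toℕ-lo adj)) (swapℕ-left p))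

  toℕ-s-hi : ∀ {p} (adj : Adj p) → toℕ (s p (hi adj)) ≡ p
  toℕ-s-hi {p} adj = trans (toℕ-s adj (hi adj)) (trans (cong (swapℕ p) (toℕ-hi adj)) (swapℕ-right p))

  s-injective : ∀ {p} → Adj p → Injective _≡_ _≡_ (s p)
  s-injective {p} adj {x} {y} sx≡sy = trans (sym (s-involutive adj x)) (trans (cong (s p) sx≡sy) (s-involutive adj y))

  ⟦_⟧ : List ℕ → Fin n → Fin n
  ⟦ [] ⟧    t = t
  ⟦ p ∷ w ⟧ t = ⟦ w ⟧ (s p t)

  Word : (Fin n → Fin n) → Set
  Word f = ∃[ w ] All Adj w × f ≗ ⟦ w ⟧

  ⟦⟧-++ : ∀ u v t → ⟦ u ++ v ⟧ t ≡ ⟦ v ⟧ (⟦ u ⟧ t)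
  ⟦⟧-++ []      v t = refl
  ⟦⟧-++ (p ∷ u) v t = ⟦⟧-++ u v (s p t)

  ⟦⟧-reverse-∷ : ∀ p w t → ⟦ reverse (p ∷ w) ⟧ t ≡ s p (⟦ reverse w ⟧ t)
  ⟦⟧-reverse-∷ p w t = trans (cong (λ u → ⟦ u ⟧ t) (unfold-reverse p w)) (⟦⟧-++ (reverse w) (p ∷ []) t)

  ⟦reverse⟧-inverseˡ : ∀ {w} → All Adj w → ∀ t → ⟦ reverse w ⟧ (⟦ w ⟧ t) ≡ t
  ⟦reverse⟧-inverseˡ []                  t = refl
  ⟦reverse⟧-inverseˡ {p ∷ w} (adj ∷ adjs) t = begin
    ⟦ reverse (p ∷ w) ⟧ (⟦ w ⟧ (s p t)) ≡⟨ ⟦⟧-reverse-∷ p w _ ⟩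
    s p (⟦ reverse w ⟧ (⟦ w ⟧ (s p t))) ≡⟨ cong (s p) (⟦reverse⟧-inverseˡ adjs (s p t)) ⟩
    s p (s p t)                         ≡⟨ s-involutive adj t ⟩
    t                                   ∎
    where open ≡-Reasoning

  ⟦reverse⟧-inverseʳ : ∀ {w} → All Adj w → ∀ t → ⟦ w ⟧ (⟦ reverse w ⟧ t) ≡ t
  ⟦reverse⟧-inverseʳ []                  t = refl
  ⟦reverse⟧-inverseʳ {p ∷ w} (adj ∷ adjs) t = begin
    ⟦ w ⟧ (s p (⟦ reverse (p ∷ w) ⟧ t))   ≡⟨ cong (⟦ w ⟧ ∘ s p) (⟦⟧-reverse-∷ p w t) ⟩
    ⟦ w ⟧ (s p (s p (⟦ reverse w ⟧ t)))   ≡⟨ cong ⟦ w ⟧ (s-involutive adj _) ⟩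
    ⟦ w ⟧ (⟦ reverse w ⟧ t)               ≡⟨ ⟦reverse⟧-inverseʳ adjs t ⟩
    t                                     ∎
    where open ≡-Reasoning

  ⟦⟧-bijective : ∀ {w} → All Adj w → Bijective _≡_ _≡_ ⟦ w ⟧
  ⟦⟧-bijective {w} adjs =
    (λ {x} {y} eq → trans (sym (⟦reverse⟧-inverseˡ adjs x)) (trans (cong ⟦ reverse w ⟧ eq) (⟦reverse⟧-inverseˡ adjs y))) ,
    (λ y → ⟦ reverse w ⟧ y , λ {x} x≡ → trans (cong ⟦ w ⟧ x≡) (⟦reverse⟧-inverseʳ adjs y))

  cycleWord : ℕ → ℕ → List ℕ
  cycleWord p zero    = []
  cycleWord p (suc a) = p ∷ cycleWord (suc p) a

  private
    cycle-head-adj : ∀ p a → p + suc a + 1 ≤ n → Adj p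
    cycle-head-adj p a k≤n = ≤-trans (m≤m+n (suc (suc p)) a) (subst (_≤ n) (p+[1+a]+1≡2+p+a p a) k≤n)
      where
      p+[1+a]+1≡2+p+a : ∀ p a → p + suc a + 1 ≡ suc (suc p) + a
      p+[1+a]+1≡2+p+a = solve-∀

    cycle-tail-bound : ∀ p a → p + suc a + 1 ≤ n → suc p + a + 1 ≤ n
    cycle-tail-bound p a = subst (_≤ n) (cong (_+ 1) (+-suc p a))

  cycleWord-adj : ∀ p a → p + a + 1 ≤ n → All Adj (cycleWord p a)
  cycleWord-adj p zero    _   = []
  cycleWord-adj p (suc a) k≤n = cycle-head-adj p a k≤n ∷ cycleWord-adj (suc p) a (cycle-tail-bound p a k≤n)

  block-cycleWord : ∀ p a → p + a + 1 ≤ n → block p a 1 ≗ ⟦ cycleWord p a ⟧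
  block-cycleWord p zero k≤n t =
    toℕ-injective (trans (toℕ-block p 0 1 k≤n t) (blockSwap-identityˡ p 1 (toℕ t)))
  block-cycleWord p (suc a) k≤n t = trans split (block-cycleWord (suc p) a k′≤n (s p t))
    where
    open ≡-Reasoning
    k′≤n = cycle-tail-bound p a k≤n
    split : block p (suc a) 1 t ≡ block (suc p) a 1 (s p t)
    split = toℕ-injective (begin
      toℕ (block p (suc a) 1 t)                      ≡⟨ toℕ-block p (suc a) 1 k≤n t ⟩
      blockSwap p (suc a) 1 (toℕ t)                  ≡⟨ blockSwap-splitˡ p a (toℕ t) ⟩
      blockSwap (suc p) a 1 (swapℕ p (toℕ t))        ≡⟨ cong (blockSwap (suc p) a 1) (toℕ-s (cycle-head-adj p a k≤n) t) ⟨
      blockSwap (suc p) a 1 (toℕ (s p t))            ≡⟨ toℕ-block (suc p) a 1 k′≤n (s p t) ⟨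
      toℕ (block (suc p) a 1 (s p t))                ∎)

  length-cycleWord : ∀ p a → length (cycleWord p a) ≡ a
  length-cycleWord p zero    = refl
  length-cycleWord p (suc a) = cong suc (length-cycleWord (suc p) a)

  blockWord : ℕ → ℕ → ℕ → List ℕ
  blockWord i a zero    = []
  blockWord i a (suc b) = cycleWord (i + b) a ++ blockWord i a b

  private
    block-head-bound : ∀ i a b → i + a + suc b ≤ n → i + b + a + 1 ≤ n
    block-head-bound i a b = subst (_≤ n) (i+a+[1+b]≡i+b+a+1 i a b)

    block-tail-bound : ∀ i a b → i + a + suc b ≤ n → i + a + b ≤ n
    block-tail-bound i a b = ≤-trans (+-monoʳ-≤ (i + a) (n≤1+n b))

  blockWord-adj : ∀ i a b → i + a + b ≤ n → All Adj (blockWord i a b)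
  blockWord-adj i a zero    _   = []
  blockWord-adj i a (suc b) k≤n =
    ++⁺ (cycleWord-adj (i + b) a (block-head-bound i a b k≤n)) (blockWord-adj i a b (block-tail-bound i a b k≤n))

  block-blockWord : ∀ i a b → i + a + b ≤ n → block i a b ≗ ⟦ blockWord i a b ⟧
  block-blockWord i a zero k≤n t =
    toℕ-injective (trans (toℕ-block i a 0 k≤n t) (blockSwap-identityʳ i a (toℕ t)))
  block-blockWord i a (suc b) k≤n t = begin
    block i a (suc b) t                               ≡⟨ split ⟩
    block i a b (block (i + b) a 1 t)                 ≡⟨ block-blockWord i a b k′≤n _ ⟩
    ⟦ blockWord i a b ⟧ (block (i + b) a 1 t)         ≡⟨ cong ⟦ blockWord i a b ⟧ (block-cycleWord (i + b) a k″≤n t) ⟩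
    ⟦ blockWord i a b ⟧ (⟦ cycleWord (i + b) a ⟧ t)   ≡⟨ ⟦⟧-++ (cycleWord (i + b) a) (blockWord i a b) t ⟨
    ⟦ blockWord i a (suc b) ⟧ t                       ∎
    where
    open ≡-Reasoning
    k′≤n = block-tail-bound i a b k≤n
    k″≤n = block-head-bound i a b k≤n
    split : block i a (suc b) t ≡ block i a b (block (i + b) a 1 t)
    split = toℕ-injective (begin
      toℕ (block i a (suc b) t)                          ≡⟨ toℕ-block i a (suc b) k≤n t ⟩
      blockSwap i a (suc b) (toℕ t)                      ≡⟨ blockSwap-splitʳ i a b (toℕ t) ⟩
      blockSwap i a b (blockSwap (i + b) a 1 (toℕ t))    ≡⟨ cong (blockSwap i a b) (toℕ-block (i + b) a 1 k″≤n t) ⟨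
      blockSwap i a b (toℕ (block (i + b) a 1 t))        ≡⟨ toℕ-block i a b k′≤n _ ⟨
      toℕ (block i a b (block (i + b) a 1 t))            ∎)

  length-blockWord : ∀ i a b → length (blockWord i a b) ≡ a * b
  length-blockWord i a zero    = sym (*-zeroʳ a)
  length-blockWord i a (suc b) = begin
    length (cycleWord (i + b) a ++ blockWord i a b)            ≡⟨ length-++ (cycleWord (i + b) a) ⟩
    length (cycleWord (i + b) a) + length (blockWord i a b)    ≡⟨ cong₂ _+_ (length-cycleWord (i + b) a) (length-blockWord i a b) ⟩
    a + a * b                                                  ≡⟨ *-suc a b ⟨
    a * suc b                                                  ∎
    where open ≡-Reasoning

module Inversions (n : ℕ) where

  open Words n

  inverted : (Fin n → Fin n) → Fin n → Fin n → ℕ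
  inverted f a b = if (toℕ a <ᵇ toℕ b) ∧ (toℕ (f b) <ᵇ toℕ (f a)) then 1 else 0

  inversions-∑ : ∀ f → inversions f ≡ ∑[ a < n ] ∑[ b < n ] inverted f a b
  inversions-∑ f = trans (cong ListAction.sum (map-cong (λ a → listSum-map-allFin (inverted f a)) (allFin n)))
                         (listSum-map-allFin (λ a → sum (inverted f a)))

  inversions-cong : ∀ {f g} → f ≗ g → inversions f ≡ inversions g
  inversions-cong {f} {g} f≗g = begin
    inversions f                           ≡⟨ inversions-∑ f ⟩
    ∑[ a < n ] ∑[ b < n ] inverted f a b   ≡⟨ sum-cong-≗ (λ a → sum-cong-≗ (λ b → cong₂ (λ u v → if (toℕ a <ᵇ toℕ b) ∧ (toℕ u <ᵇ toℕ v) then 1 else 0) (f≗g b) (f≗g a))) ⟩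
    ∑[ a < n ] ∑[ b < n ] inverted g a b   ≡⟨ inversions-∑ g ⟨
    inversions g                           ∎
    where open ≡-Reasoning

  inversions-id : inversions {n} id ≡ 0
  inversions-id = begin
    inversions {n} id                       ≡⟨ inversions-∑ id ⟩
    ∑[ a < n ] ∑[ b < n ] inverted id a b   ≡⟨ sum-cong-≗ (λ a → trans (sum-cong-≗ (inverted-id a)) (sum-replicate-zero n)) ⟩
    ∑[ a < n ] 0                            ≡⟨ sum-replicate-zero n ⟩
    0                                       ∎
    where
    open ≡-Reasoning
    inverted-id : ∀ a b → inverted id a b ≡ 0
    inverted-id a b with toℕ a <ᵇ toℕ b in a<b
    ... | false = refl
    ... | true  rewrite <ᵇ-false (<⇒≤ (<ᵇ⇒< (toℕ a) (toℕ b) (subst T (sym a<b) _))) = refl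

  module Transposition (f : Fin n → Fin n) {p} (adj : Adj p) where

    private
      c d : Fin n
      c = lo adj
      d = hi adj

      inverted′ : Fin n → Fin n → ℕ
      inverted′ a b = if (toℕ (s p a) <ᵇ toℕ (s p b)) ∧ (toℕ (f b) <ᵇ toℕ (f a)) then 1 else 0

      inversions-∘s-∑ : inversions (f ∘ s p) ≡ ∑[ a < n ] ∑[ b < n ] inverted′ a b
      inversions-∘s-∑ = begin
        inversions (f ∘ s p)                                      ≡⟨ inversions-∑ (f ∘ s p) ⟩
        ∑[ a < n ] ∑[ b < n ] inverted (f ∘ s p) a b              ≡⟨ sum-permute (λ a → sum (inverted (f ∘ s p) a)) π ⟩
        ∑[ a < n ] ∑[ b < n ] inverted (f ∘ s p) (s p a) b        ≡⟨ sum-cong-≗ (λ a → sum-permute (inverted (f ∘ s p) (s p a)) π) ⟩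
        ∑[ a < n ] ∑[ b < n ] inverted (f ∘ s p) (s p a) (s p b)  ≡⟨ sum-cong-≗ (λ a → sum-cong-≗ (λ b →
                                                                       cong₂ (λ u v → if (toℕ (s p a) <ᵇ toℕ (s p b)) ∧ (toℕ (f u) <ᵇ toℕ (f v)) then 1 else 0)
                                                                             (s-involutive adj b) (s-involutive adj a))) ⟩
        ∑[ a < n ] ∑[ b < n ] inverted′ a b                       ∎
        where
        open ≡-Reasoning
        π = permutation (s p) (s p) (s-involutive adj) (s-involutive adj)

      inverted≡inverted′ : ∀ {a b} → ¬ (a ≡ c × b ≡ d) → ¬ (a ≡ d × b ≡ c) → inverted f a b ≡ inverted′ a b
      inverted≡inverted′ {a} {b} ¬cd ¬dc = cong (λ z → if z ∧ (toℕ (f b) <ᵇ toℕ (f a)) then 1 else 0) (sym (begin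
        toℕ (s p a) <ᵇ toℕ (s p b)            ≡⟨ cong₂ _<ᵇ_ (toℕ-s adj a) (toℕ-s adj b) ⟩
        swapℕ p (toℕ a) <ᵇ swapℕ p (toℕ b)    ≡⟨ swapℕ-<ᵇ p (λ (a≡p , b≡1+p) → ¬cd (at-lo a≡p , at-hi b≡1+p))
                                                          (λ (a≡1+p , b≡p) → ¬dc (at-hi a≡1+p , at-lo b≡p)) ⟩
        toℕ a <ᵇ toℕ b                        ∎))
        where
        open ≡-Reasoning
        at-lo : ∀ {x} → toℕ x ≡ p → x ≡ c
        at-lo x≡p = toℕ-injective (trans x≡p (sym (toℕ-lo adj)))
        at-hi : ∀ {x} → toℕ x ≡ suc p → x ≡ d
        at-hi x≡1+p = toℕ-injective (trans x≡1+p (sym (toℕ-hi adj)))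

      β₁ β₂ : ℕ
      β₁ = if toℕ (f c) <ᵇ toℕ (f d) then 1 else 0
      β₂ = if toℕ (f d) <ᵇ toℕ (f c) then 1 else 0

      inverted-cd : inverted f c d ≡ β₂
      inverted-cd rewrite toℕ-lo adj | toℕ-hi adj | <ᵇ-true (n<1+n p) = refl

      inverted-dc : inverted f d c ≡ 0
      inverted-dc rewrite toℕ-lo adj | toℕ-hi adj | <ᵇ-false {suc p} {p} (n≤1+n p) = refl

      inverted′-cd : inverted′ c d ≡ 0
      inverted′-cd rewrite toℕ-s-lo adj | toℕ-s-hi adj | <ᵇ-false {suc p} {p} (n≤1+n p) = refl

      inverted′-dc : inverted′ d c ≡ β₁
      inverted′-dc rewrite toℕ-s-lo adj | toℕ-s-hi adj | <ᵇ-true (n<1+n p) = refl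

      cancel : ∀ S S′ r s′ x y → S + r + (s′ + x) ≡ S′ + (r + y) + s′ → S + x ≡ S′ + y
      cancel S S′ r s′ x y eq = +-cancelʳ-≡ (r + s′) (S + x) (S′ + y) (trans (lhs S r s′ x) (trans eq (rhs S′ r y s′)))
        where
        lhs : ∀ S r s′ x → S + x + (r + s′) ≡ S + r + (s′ + x)
        lhs = solve-∀
        rhs : ∀ S′ r y s′ → S′ + (r + y) + s′ ≡ S′ + y + (r + s′)
        rhs = solve-∀

    -- After reindexing both sums by the involution s p, the summands of
    -- inversions f and inversions (f ∘ s p) differ only at (lo adj, hi adj) and (hi adj, lo adj).
    inversions-∘s : inversions f + β₁ ≡ inversions (f ∘ s p) + β₂
    inversions-∘s = cancel (inversions f) (inversions (f ∘ s p)) (R′ c) (R d) β₁ β₂ (begin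
      inversions f + R′ c + (R d + β₁)       ≡⟨ cong (λ y → inversions f + R′ c + y) row-d ⟩
      inversions f + R′ c + R′ d             ≡⟨ cong (λ y → y + R′ c + R′ d) (inversions-∑ f) ⟩
      sum R + R′ c + R′ d                    ≡⟨ sum-exchange₂ R R′ (lo≢hi adj) (λ a a≢c a≢d →
                                                  sum-cong-≗ (λ b → inverted≡inverted′ {a} {b} (a≢c ∘ proj₁) (a≢d ∘ proj₁))) ⟩
      sum R′ + R c + R d                     ≡⟨ cong (λ y → y + R c + R d) (sym inversions-∘s-∑) ⟩
      inversions (f ∘ s p) + R c + R d       ≡⟨ cong (λ y → inversions (f ∘ s p) + y + R d) row-c ⟩
      inversions (f ∘ s p) + (R′ c + β₂) + R d ∎)
      where
      open ≡-Reasoning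
      R R′ : Fin n → ℕ
      R a  = sum (inverted f a)
      R′ a = sum (inverted′ a)
      row-c : R c ≡ R′ c + β₂
      row-c = begin
        R c                    ≡⟨ +-identityʳ (R c) ⟨
        R c + 0                ≡⟨ cong (R c +_) inverted′-cd ⟨
        R c + inverted′ c d    ≡⟨ sum-exchange₁ (inverted f c) (inverted′ c) d (λ b b≢d → inverted≡inverted′ {c} {b} (b≢d ∘ proj₂) (lo≢hi adj ∘ proj₁)) ⟩
        R′ c + inverted f c d  ≡⟨ cong (R′ c +_) inverted-cd ⟩
        R′ c + β₂              ∎
      row-d : R d + β₁ ≡ R′ d
      row-d = begin
        R d + β₁               ≡⟨ cong (R d +_) inverted′-dc ⟨
        R d + inverted′ d c    ≡⟨ sum-exchange₁ (inverted f d) (inverted′ d) c (λ b b≢c → inverted≡inverted′ {d} {b} (lo≢hi adj ∘ sym ∘ proj₁) (b≢c ∘ proj₂)) ⟩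
        R′ d + inverted f d c  ≡⟨ cong (R′ d +_) inverted-dc ⟩
        R′ d + 0               ≡⟨ +-identityʳ (R′ d) ⟩
        R′ d                   ∎

    inversions-descent : toℕ (f (hi adj)) < toℕ (f (lo adj)) → inversions f ≡ suc (inversions (f ∘ s p))
    inversions-descent fd<fc = begin
      inversions f                  ≡⟨ +-identityʳ (inversions f) ⟨
      inversions f + 0              ≡⟨ cong (inversions f +_) β₁≡0 ⟨
      inversions f + β₁             ≡⟨ inversions-∘s ⟩
      inversions (f ∘ s p) + β₂     ≡⟨ cong (inversions (f ∘ s p) +_) β₂≡1 ⟩
      inversions (f ∘ s p) + 1      ≡⟨ +-comm (inversions (f ∘ s p)) 1 ⟩
      suc (inversions (f ∘ s p))    ∎
      where
      open ≡-Reasoning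
      β₁≡0 : β₁ ≡ 0
      β₁≡0 rewrite <ᵇ-false (<⇒≤ fd<fc) = refl
      β₂≡1 : β₂ ≡ 1
      β₂≡1 rewrite <ᵇ-true fd<fc = refl

    inversions-ascent : toℕ (f (lo adj)) < toℕ (f (hi adj)) → inversions (f ∘ s p) ≡ suc (inversions f)
    inversions-ascent fc<fd = begin
      inversions (f ∘ s p)          ≡⟨ +-identityʳ (inversions (f ∘ s p)) ⟨
      inversions (f ∘ s p) + 0      ≡⟨ cong (inversions (f ∘ s p) +_) β₂≡0 ⟨
      inversions (f ∘ s p) + β₂     ≡⟨ inversions-∘s ⟨
      inversions f + β₁             ≡⟨ cong (inversions f +_) β₁≡1 ⟩
      inversions f + 1              ≡⟨ +-comm (inversions f) 1 ⟩
      suc (inversions f)            ∎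
      where
      open ≡-Reasoning
      β₁≡1 : β₁ ≡ 1
      β₁≡1 rewrite <ᵇ-true fc<fd = refl
      β₂≡0 : β₂ ≡ 0
      β₂≡0 rewrite <ᵇ-false (<⇒≤ fc<fd) = refl

    parity-inversions-∘s : Injective _≡_ _≡_ f → parity (inversions (f ∘ s p)) ≡ parity (inversions f) ⁻¹
    parity-inversions-∘s f-inj with <-cmp (toℕ (f c)) (toℕ (f d))
    ... | tri< fc<fd _ _ = trans (cong parity (inversions-ascent fc<fd)) (parity-suc (inversions f))
    ... | tri≈ _ fc≡fd _ = contradiction (f-inj (toℕ-injective fc≡fd)) (lo≢hi adj)
    ... | tri> _ _ fd<fc = begin
      parity (inversions (f ∘ s p))          ≡⟨ ⁻¹-involutive _ ⟨
      parity (inversions (f ∘ s p)) ⁻¹ ⁻¹    ≡⟨ cong _⁻¹ (parity-suc (inversions (f ∘ s p))) ⟨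
      parity (suc (inversions (f ∘ s p))) ⁻¹ ≡⟨ cong (λ k → parity k ⁻¹) (inversions-descent fd<fc) ⟨
      parity (inversions f) ⁻¹               ∎
      where open ≡-Reasoning

  parity-inversions-⟦⟧ : ∀ {w} → All Adj w → parity (inversions ⟦ w ⟧) ≡ parity (length w)
  parity-inversions-⟦⟧ []                  = cong parity inversions-id
  parity-inversions-⟦⟧ {p ∷ w} (adj ∷ adjs) = begin
    parity (inversions (⟦ w ⟧ ∘ s p))   ≡⟨ Transposition.parity-inversions-∘s ⟦ w ⟧ adj (proj₁ (⟦⟧-bijective adjs)) ⟩
    parity (inversions ⟦ w ⟧) ⁻¹        ≡⟨ cong _⁻¹ (parity-inversions-⟦⟧ adjs) ⟩
    parity (length w) ⁻¹                ≡⟨ parity-suc (length w) ⟨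
    parity (suc (length w))             ∎
    where open ≡-Reasoning

module BubbleSort (n : ℕ) where

  open Words n
  open Inversions n

  Descent : (Fin n → Fin n) → Set
  Descent f = ∃[ p ] Σ (Adj p) λ adj → toℕ (f (hi adj)) < toℕ (f (lo adj))

  Sorted : (Fin n → Fin n) → Set
  Sorted f = ∀ p (adj : Adj p) → toℕ (f (lo adj)) ≤ toℕ (f (hi adj))

  descent-or-sortedBelow : ∀ f K → Descent f ⊎ (∀ p → p < K → (adj : Adj p) → toℕ (f (lo adj)) ≤ toℕ (f (hi adj)))
  descent-or-sortedBelow f zero = inj₂ λ _ ()
  descent-or-sortedBelow f (suc K) with descent-or-sortedBelow f K
  ... | inj₁ desc = inj₁ desc
  ... | inj₂ sorted with suc K <? n
  ...   | no ¬adj = inj₂ λ p p<1+K adj → case m<1+n⇒m<n∨m≡n p<1+K of λ where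
            (inj₁ p<K)  → sorted p p<K adj
            (inj₂ refl) → contradiction adj ¬adj
  ...   | yes adjK with toℕ (f (hi adjK)) <? toℕ (f (lo adjK))
  ...     | yes desc = inj₁ (K , adjK , desc)
  ...     | no ¬desc = inj₂ λ p p<1+K adj → case m<1+n⇒m<n∨m≡n p<1+K of λ where
              (inj₁ p<K)  → sorted p p<K adj
              (inj₂ refl) → ≮⇒≥ ¬desc

  descent-or-sorted : ∀ f → Descent f ⊎ Sorted f
  descent-or-sorted f = Sum.map₂ (λ sorted p adj → sorted p (<-trans (n<1+n p) adj) adj) (descent-or-sortedBelow f n)

  -- Injectivity makes a sorted f strictly increasing; then t ≤ f t follows by induction
  -- upwards from 0, and f t ≤ t by induction downwards from n-1.
  sorted-injective⇒id : ∀ {f} → Injective _≡_ _≡_ f → Sorted f → f ≗ id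
  sorted-injective⇒id {f} f-inj sorted t = trans (cong f (sym (fromℕ<-toℕ t (toℕ<n t))))
    (toℕ-injective (≤-antisym (F-at-most (toℕ t) (toℕ<n t)) (F-at-least (toℕ t) (toℕ<n t))))
    where
    F : ∀ t → .(t < n) → ℕ
    F t t<n = toℕ (f (fromℕ< t<n))

    increasing : ∀ p (adj : Adj p) → F p (<-trans (n<1+n p) adj) < F (suc p) adj
    increasing p adj = ≤∧≢⇒< (sorted p adj) (λ eq → lo≢hi adj (f-inj (toℕ-injective eq)))

    F-at-least : ∀ t (t<n : t < n) → t ≤ F t t<n
    F-at-least zero    _     = z≤n
    F-at-least (suc t) 1+t<n = ≤-<-trans (F-at-least t (<-trans (n<1+n t) 1+t<n)) (increasing t 1+t<n)

    F+d<n : ∀ d t (t<n : t < n) → t + d < n → F t t<n + d < n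
    F+d<n zero    t _ _       = subst (_< n) (sym (+-identityʳ _)) (toℕ<n _)
    F+d<n (suc d) t _ t+1+d<n = subst (_< n) (sym (+-suc _ d))
      (≤-<-trans (+-monoˡ-≤ d (increasing t 1+t<n)) (F+d<n d (suc t) 1+t<n 1+t+d<n))
      where
      1+t+d<n : suc t + d < n
      1+t+d<n = subst (_< n) (+-suc t d) t+1+d<n
      1+t<n : suc t < n
      1+t<n = ≤-<-trans (m≤m+n (suc t) d) 1+t+d<n

    F-at-most : ∀ t (t<n : t < n) → F t t<n ≤ t
    F-at-most t t<n = ≤-pred (+-cancelʳ-< d (F t t<n) (suc t) (subst (F t t<n + d <_) (sym (m+[n∸m]≡n t<n)) (F+d<n d t t<n t+d<n)))
      where
      d = n ∸ suc t
      t+d<n : t + d < n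
      t+d<n = subst (t + d <_) (m+[n∸m]≡n t<n) (n<1+n (t + d))

  private
    injective⇒Word′ : ∀ k {f} → inversions f ≡ k → Injective _≡_ _≡_ f → Word f
    injective⇒Word′ k {f} inv≡k f-inj with descent-or-sorted f
    ... | inj₂ sorted = [] , [] , sorted-injective⇒id f-inj sorted
    ... | inj₁ (p , adj , desc) with k | trans (sym (Transposition.inversions-descent f adj desc)) inv≡k
    ...   | zero  | ()
    ...   | suc k | inv≡1+k with injective⇒Word′ k (suc-injective inv≡1+k) (s-injective adj ∘ f-inj)
    ...     | w , adjs , f∘s≗w = p ∷ w , adj ∷ adjs , λ t → trans (cong f (sym (s-involutive adj t))) (f∘s≗w (s p t))

  injective⇒Word : ∀ {f} → Injective _≡_ _≡_ f → Word f
  injective⇒Word f-inj = injective⇒Word′ _ refl f-inj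

module Generation (m : ℕ) where

  N : ℕ
  N = suc (suc (suc m))

  open Words N
  open Inversions N
  open BubbleSort N

  H : (Fin N → Fin N) → Set
  H = ⟨ V N ⟩

  e : ℕ → List (ℕ × ℕ × ℕ)
  e l = (l , suc l , l + 3) ∷ (l , l + 2 , l + 3) ∷ []

  Admissible : ℕ × ℕ × ℕ → Set
  Admissible (i , j , k) = i ≤ j × j ≤ k × k ≤ N × (parity N ≡ 0ℙ → parity ((j ∸ i) * (k ∸ j)) ≡ 0ℙ)

  e-admissible : ∀ {l y} → l < suc m → y ∈ e l → Admissible y
  e-admissible {l} l<1+m (here refl) =
    n≤1+n l , subst (suc l ≤_) (sym (+-suc l 2)) (s≤s (m≤m+n l 2)) , l+3≤N , λ _ → parity-*-evenʳ (suc l ∸ l) _ (cong parity k∸j≡2)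
    where
    l+3≤N = subst (_≤ N) (+-comm 3 l) (s≤s (s≤s (s≤s (≤-pred l<1+m))))
    k∸j≡2 : l + 3 ∸ suc l ≡ 2
    k∸j≡2 = trans (cong (_∸ suc l) (+-suc l 2)) (m+n∸m≡n l 2)
  e-admissible {l} l<1+m (there (here refl)) =
    m≤m+n l 2 , +-monoʳ-≤ l (n≤1+n 2) , l+3≤N , λ _ → parity-*-evenˡ (l + 2 ∸ l) _ (cong parity (m+n∸m≡n l 2))
    where
    l+3≤N = subst (_≤ N) (+-comm 3 l) (s≤s (s≤s (s≤s (≤-pred l<1+m))))

  triples-admissible : ∀ {y} → y ∈ triples N → Admissible y
  triples-admissible {y} y∈ with ∈-++⁻ (concatMap e (upTo (suc m))) y∈
  ... | inj₁ y∈eₗ with find (∈-concatMap⁻ e {xs = upTo (suc m)} y∈eₗ)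
  ...   | l , l∈ , y∈e = e-admissible (∈-upTo⁻ l∈) y∈e
  triples-admissible _ | inj₂ (here refl) =
    z≤n , n≤1+n (suc m) , n≤1+n _ , λ N-even → parity-*-evenˡ (suc m) (suc (suc m) ∸ suc m) N-even
  triples-admissible _ | inj₂ (there (here refl)) =
    z≤n , ≤-trans (n≤1+n (suc m)) (n≤1+n _) , ≤-refl , λ N-even → parity-*-evenˡ (suc m) (N ∸ suc m) N-even
  triples-admissible _ | inj₂ (there (there (here refl))) =
    s≤s z≤n , n≤1+n _ , ≤-refl , λ N-even → parity-*-evenˡ (suc m) (N ∸ suc (suc m)) N-even
  triples-admissible _ | inj₂ (there (there (there (here refl)))) =
    z≤n , s≤s z≤n , n≤1+n _ , λ N-even → parity-*-evenʳ 1 (suc m) N-even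
  triples-admissible _ | inj₂ (there (there (there (there (here refl))))) =
    z≤n , s≤s (s≤s z≤n) , ≤-refl , λ _ → parity-*-evenˡ 2 (N ∸ 2) refl
  triples-admissible _ | inj₂ (there (there (there (there (there (here refl)))))) =
    s≤s z≤n , s≤s (s≤s z≤n) , ≤-refl , λ N-even → parity-*-evenʳ 1 (suc m) N-even

  σ-word : ∀ {i j k} → i ≤ j → j ≤ k → k ≤ N →
           ∃[ w ] All Adj w × length w ≡ (j ∸ i) * (k ∸ j) × σ N i j k ≗ ⟦ w ⟧
  σ-word {i} {j} {k} i≤j j≤k k≤N =
    blockWord i a b , blockWord-adj i a b bound , length-blockWord i a b ,
    λ t → trans (cong (λ (j′ , k′) → σ N i j′ k′ t) (sym (×-≡,≡→≡ (i+a≡j , i+a+b≡k)))) (block-blockWord i a b bound t)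
    where
    a = j ∸ i
    b = k ∸ j
    i+a≡j : i + a ≡ j
    i+a≡j = m+[n∸m]≡n i≤j
    i+a+b≡k : i + a + b ≡ k
    i+a+b≡k = trans (cong (_+ b) i+a≡j) (m+[n∸m]≡n j≤k)
    bound : i + a + b ≤ N
    bound = subst (_≤ N) (sym i+a+b≡k) k≤N

  ParityWord : (Fin N → Fin N) → Set
  ParityWord f = ∃[ w ] All Adj w × f ≗ ⟦ w ⟧ × (parity N ≡ 0ℙ → parity (length w) ≡ 0ℙ)

  H⇒ParityWord : ∀ {f} → H f → ParityWord f
  H⇒ParityWord (gen ((i , j , k) , mem , f≗σ)) with triples-admissible mem
  ... | i≤j , j≤k , k≤N , even with σ-word i≤j j≤k k≤N
  ...   | w , adjs , len , σ≗w = w , adjs , (λ t → trans (f≗σ t) (σ≗w t)) , λ N-even → trans (cong parity len) (even N-even)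
  H⇒ParityWord one = [] , [] , (λ _ → refl) , λ _ → refl
  H⇒ParityWord (comp {f} Hf Hg) with H⇒ParityWord Hf | H⇒ParityWord Hg
  ... | u , adjsᵤ , f≗u , evenᵤ | v , adjsᵥ , g≗v , evenᵥ =
    v ++ u , ++⁺ adjsᵥ adjsᵤ , (λ t → trans (trans (cong f (g≗v t)) (f≗u _)) (sym (⟦⟧-++ v u t))) ,
    λ N-even → trans (parity-length-++ v u) (cong₂ ℙ._+_ (evenᵥ N-even) (evenᵤ N-even))
  H⇒ParityWord (inv {f} {g} Hf _ gf≗id) with H⇒ParityWord Hf
  ... | w , adjs , f≗w , even =
    reverse w , All-resp-↭ (↭-sym (↭-reverse w)) adjs , g≗w⁻¹ ,
    λ N-even → trans (cong parity (length-reverse w)) (even N-even)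
    where
    g≗w⁻¹ : g ≗ ⟦ reverse w ⟧
    g≗w⁻¹ t = begin
      g t                                  ≡⟨ cong g (⟦reverse⟧-inverseʳ adjs t) ⟨
      g (⟦ w ⟧ (⟦ reverse w ⟧ t))          ≡⟨ cong g (f≗w _) ⟨
      g (f (⟦ reverse w ⟧ t))              ≡⟨ gf≗id (⟦ reverse w ⟧ t) ⟩
      ⟦ reverse w ⟧ t                      ∎
      where open ≡-Reasoning
  H⇒ParityWord (ext Hf f≗g) with H⇒ParityWord Hf
  ... | w , adjs , f≗w , even = w , adjs , (λ t → trans (sym (f≗g t)) (f≗w t)) , even

  H-++ : ∀ {u v} → H ⟦ u ⟧ → H ⟦ v ⟧ → H ⟦ u ++ v ⟧
  H-++ {u} {v} Hu Hv = ext (comp Hv Hu) (λ t → sym (⟦⟧-++ u v t))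

  H-reverse : ∀ {w} → All Adj w → H ⟦ w ⟧ → H ⟦ reverse w ⟧
  H-reverse adjs Hw = inv Hw (⟦reverse⟧-inverseʳ adjs) (⟦reverse⟧-inverseˡ adjs)

  H-σ : ∀ {i j k} → (i , j , k) ∈ triples N → H (σ N i j k)
  H-σ mem = gen (_ , mem , λ _ → refl)

  H-adjacentPair : ∀ a → Adj (suc a) → H ⟦ suc a ∷ a ∷ [] ⟧
  H-adjacentPair a adj = ext (H-σ mem) σ≗
    where
    open ≡-Reasoning
    mem : (a , suc a , a + 3) ∈ triples N
    mem = ∈-++⁺ˡ (∈-concatMap⁺ e (Any.map (λ { refl → here refl }) (∈-upTo⁺ (≤-pred (≤-pred adj)))))
    a+1+2≡a+3 : a + 1 + 2 ≡ a + 3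
    a+1+2≡a+3 = +-assoc a 1 2
    bound : a + 1 + 2 ≤ N
    bound = subst (_≤ N) (trans (+-comm 3 a) (sym a+1+2≡a+3)) adj
    σ≗ : ∀ t → σ N a (suc a) (a + 3) t ≡ ⟦ suc a ∷ a ∷ [] ⟧ t
    σ≗ t = begin
      σ N a (suc a) (a + 3) t        ≡⟨ cong₂ (λ j k → σ N a j k t) (+-comm 1 a) (sym a+1+2≡a+3) ⟩
      block a 1 2 t                  ≡⟨ block-blockWord a 1 2 bound t ⟩
      ⟦ a + 1 ∷ a + 0 ∷ [] ⟧ t       ≡⟨ cong₂ (λ x y → ⟦ x ∷ y ∷ [] ⟧ t) (+-comm a 1) (+-identityʳ a) ⟩
      ⟦ suc a ∷ a ∷ [] ⟧ t           ∎

  H-pairAtDistance : ∀ y d → Adj (y + d) → H ⟦ y + d ∷ y ∷ [] ⟧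
  H-pairAtDistance y zero adj = ext one (λ t → sym (trans (cong (λ x → s y (s x t)) (+-identityʳ y))
                                                           (s-involutive (subst Adj (+-identityʳ y) adj) t)))
  H-pairAtDistance y (suc d) adj =
    ext (H-++ {suc y + d ∷ suc y ∷ []} {suc y ∷ y ∷ []} (H-pairAtDistance (suc y) d (subst Adj (+-suc y d) adj)) (H-adjacentPair y adj₁₊y))
        (λ t → cong (s y) (trans (s-involutive adj₁₊y _) (cong (λ x → s x t) (sym (+-suc y d)))))
    where
    adj₁₊y : Adj (suc y)
    adj₁₊y = ≤-<-trans (s≤s (subst (suc y ≤_) (sym (+-suc y d)) (s≤s (m≤m+n y d)))) adj

  H-pair : ∀ {x y} → Adj x → Adj y → H ⟦ x ∷ y ∷ [] ⟧
  H-pair {x} {y} adjₓ adjᵧ with ≤-total y x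
  ... | inj₁ y≤x = ext (H-pairAtDistance y (x ∸ y) (subst Adj (sym y+d≡x) adjₓ)) (λ t → cong (λ z → ⟦ z ∷ y ∷ [] ⟧ t) y+d≡x)
    where y+d≡x = m+[n∸m]≡n y≤x
  ... | inj₂ x≤y = H-reverse (adjᵧ ∷ adjₓ ∷ [])
                     (ext (H-pairAtDistance x (y ∸ x) (subst Adj (sym x+d≡y) adjᵧ)) (λ t → cong (λ z → ⟦ z ∷ x ∷ [] ⟧ t) x+d≡y))
    where x+d≡y = m+[n∸m]≡n x≤y

  H-evenWord : ∀ {w} → All Adj w → parity (length w) ≡ 0ℙ → H ⟦ w ⟧
  H-evenWord []                   _    = one
  H-evenWord (_ ∷ [])             ()
  H-evenWord {x ∷ y ∷ w} (adjₓ ∷ adjᵧ ∷ adjs) even = H-++ {x ∷ y ∷ []} {w} (H-pair adjₓ adjᵧ) (H-evenWord adjs even)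

  -- An odd word w₀ in H turns every odd word w into the even word w ++ reverse w₀, times w₀.
  H-allWords : ∀ {w₀} → All Adj w₀ → parity (length w₀) ≡ 1ℙ → H ⟦ w₀ ⟧ → ∀ {w} → All Adj w → H ⟦ w ⟧
  H-allWords {w₀} adjs₀ odd₀ Hw₀ {w} adjs with parity (length w) in parity-w
  ... | 0ℙ = H-evenWord adjs parity-w
  ... | 1ℙ = ext (H-++ {w ++ reverse w₀} {w₀} (H-evenWord (++⁺ adjs (All-resp-↭ (↭-sym (↭-reverse w₀)) adjs₀)) even) Hw₀) w≗
    where
    even : parity (length (w ++ reverse w₀)) ≡ 0ℙ
    even = trans (parity-length-++ w (reverse w₀)) (cong₂ ℙ._+_ parity-w (trans (cong parity (length-reverse w₀)) odd₀))
    w≗ : ∀ t → ⟦ (w ++ reverse w₀) ++ w₀ ⟧ t ≡ ⟦ w ⟧ t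
    w≗ t = begin
      ⟦ (w ++ reverse w₀) ++ w₀ ⟧ t          ≡⟨ ⟦⟧-++ (w ++ reverse w₀) w₀ t ⟩
      ⟦ w₀ ⟧ (⟦ w ++ reverse w₀ ⟧ t)         ≡⟨ cong ⟦ w₀ ⟧ (⟦⟧-++ w (reverse w₀) t) ⟩
      ⟦ w₀ ⟧ (⟦ reverse w₀ ⟧ (⟦ w ⟧ t))      ≡⟨ ⟦reverse⟧-inverseʳ adjs₀ (⟦ w ⟧ t) ⟩
      ⟦ w ⟧ t                                ∎
      where open ≡-Reasoning

  -- The generator σ(0,1,n-1) of e_{n-1} is a word of length n-2.
  H-oddWord : parity N ≡ 1ℙ → ∃[ w ] All Adj w × parity (length w) ≡ 1ℙ × H ⟦ w ⟧
  H-oddWord N-odd =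
    let i≤j , j≤k , k≤N , _     = triples-admissible mem
        w , adjs , len , σ≗w   = σ-word i≤j j≤k k≤N
    in w , adjs , trans (cong parity (trans len (*-identityˡ (suc m)))) N-odd , ext (H-σ mem) σ≗w
    where
    mem : (0 , 1 , suc (suc m)) ∈ triples N
    mem = ∈-++⁺ʳ (concatMap e (upTo (suc m))) (there (there (there (here refl))))

  H⇒bijective : ∀ {f} → H f → Bijective _≡_ _≡_ f
  H⇒bijective Hf = let w , adjs , f≗w , _ = H⇒ParityWord Hf in ≗-bijective f≗w (⟦⟧-bijective adjs)

  H-odd : ¬ 2 ∣ N → ∀ f → Bijective _≡_ _≡_ f ⇔ H f
  H-odd ¬2∣N f = mk⇔ bijective⇒H H⇒bijective
    where
    bijective⇒H : Bijective _≡_ _≡_ f → H f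
    bijective⇒H (f-inj , _) =
      let w  , adjs  , f≗w       = injective⇒Word f-inj
          w₀ , adjs₀ , odd₀ , Hw₀ = H-oddWord (¬2∣⇒parity≡1ℙ ¬2∣N)
      in ext (H-allWords adjs₀ odd₀ Hw₀ adjs) (sym ∘ f≗w)

  H-even : 2 ∣ N → ∀ f → (Bijective _≡_ _≡_ f × 2 ∣ inversions f) ⇔ H f
  H-even 2∣N f = mk⇔ even⇒H λ Hf → H⇒bijective Hf , parity≡0ℙ⇒2∣ _ (H⇒even Hf)
    where
    parity-inversions : ∀ {w} → All Adj w → f ≗ ⟦ w ⟧ → parity (inversions f) ≡ parity (length w)
    parity-inversions adjs f≗w = trans (cong parity (inversions-cong f≗w)) (parity-inversions-⟦⟧ adjs)
    even⇒H : Bijective _≡_ _≡_ f × 2 ∣ inversions f → H f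
    even⇒H ((f-inj , _) , 2∣inv) =
      let w , adjs , f≗w = injective⇒Word f-inj
      in ext (H-evenWord adjs (trans (sym (parity-inversions adjs f≗w)) (2∣⇒parity≡0ℙ 2∣inv))) (sym ∘ f≗w)
    H⇒even : H f → parity (inversions f) ≡ 0ℙ
    H⇒even Hf = let w , adjs , f≗w , even = H⇒ParityWord Hf in trans (parity-inversions adjs f≗w) (even (2∣⇒parity≡0ℙ 2∣N))

lemma12 : (n : ℕ) → 3 ≤ n →
    (¬ (2 ∣ n) → (f : Fin n → Fin n) → (Bijective _≡_ _≡_ f ⇔ ⟨ V n ⟩ f))
    × (2 ∣ n → (f : Fin n → Fin n) →
         ((Bijective _≡_ _≡_ f × 2 ∣ inversions f) ⇔ ⟨ V n ⟩ f))
lemma12 (suc (suc (suc m))) (s≤s (s≤s (s≤s z≤n))) = H-odd , H-even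
  where open Generation m
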